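{- Let $C=\mathbb{Z}_n$, let $N\le\Phi(C)$, let $g\in C$ and $h\in N$, and let $S=g+\langle h\rangle$. Suppose every element of $S$ has order $n$. Then $\mathrm{Aut}(C,S)=\{\sigma\in\mathrm{Aut}(C):\sigma(S)=S\}$ is transitive on $S$.
   Context: $\Phi(C)$ denotes the Frattini subgroup of $C$ (the intersection of all maximal subgroups of $C$). -}

module Defs where

open import Data.Nat using (ℕ; zero; suc; _+_; _∸_; _<_; NonZero)
open import Data.Nat.DivMod using (_mod_)
open import Data.Fin using (Fin; toℕ)
open import Data.Product using (Σ; ∃; _×_)
open import Data.Sum using (_⊎_)
open import Relation.Nullary using (¬_)
open import Relation.Binary.PropositionalEquality using (_≡_)
open import Function.Definitions using (Bijective)
open import Level using (Level)

module _ (n : ℕ) .{{_ : NonZero n}} where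

  C : Set
  C = Fin n

  0C : C
  0C = 0 mod n

  _⊕_ : C → C → C
  x ⊕ y = (toℕ x + toℕ y) mod n

  ⊖_ : C → C
  ⊖ x = (n ∸ toℕ x) mod n

  _·_ : ℕ → C → C
  zero · x = 0C
  suc k · x = x ⊕ (k · x)

  IsSubgroup : (C → Set) → Set
  IsSubgroup P = P 0C × (∀ x y → P x → P y → P (x ⊕ y)) × (∀ x → P x → P (⊖ x))

  IsMaximal : (C → Set) → Set₁
  IsMaximal M = IsSubgroup M × (∃ λ x → ¬ M x)
    × (∀ (K : C → Set) → IsSubgroup K → (∀ x → M x → K x) → (∃ λ x → ¬ K x)
         → ∀ x → K x → M x)

  Φ : C → Set₁
  Φ x = ∀ (M : C → Set) → IsMaximal M → M x

  HasOrder : C → ℕ → Set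
  HasOrder x k = (0 < k) × (k · x ≡ 0C) × (∀ j → 0 < j → j < k → ¬ (j · x ≡ 0C))

  Coset : C → C → C → Set
  Coset g h y = ∃ λ k → y ≡ g ⊕ (k · h)

  IsAut : (C → C) → Set
  IsAut σ = (∀ x y → σ (x ⊕ y) ≡ σ x ⊕ σ y) × Bijective _≡_ _≡_ σ

  Stabilises : (C → C) → (C → Set) → Set
  Stabilises σ S = (∀ y → S y → S (σ y)) × (∀ y → S y → ∃ λ x → S x × σ x ≡ y)

module Submission where

-- Every element of S = g + ⟨h⟩ has order n, so every s ∈ S is a unit of ℤ_n
-- (an element of order n has value coprime to n, hence invertible by Bézout).
-- For s, t ∈ S the scaling x ↦ u x with u = t s⁻¹ is an automorphism of ℤ_n
-- sending s to t, and it maps s + ⟨h⟩ = S into t + u⟨h⟩ ⊆ t + ⟨h⟩ = S; its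
-- inverse scaling does the same with s and t exchanged, so σ(S) = S.

open import Defs
open import Data.Nat using (ℕ; NonZero; zero; suc; _+_; _*_; _<_; pred; z≤n; s≤s; >-nonZero⁻¹)
open import Data.Nat.Properties
open import Data.Nat.DivMod
open import Data.Nat.Divisibility using (divides)
open import Data.Nat.Coprimality using (Coprime; coprime-Bézout)
open import Data.Nat.GCD using (module Bézout)
open import Data.Nat.Tactic.RingSolver using (solve-∀)
open import Algebra.Properties.CommutativeSemigroup *-commutativeSemigroup using (x∙yz≈y∙xz)
open import Data.Fin using (toℕ)
open import Data.Fin.Properties using (toℕ-injective; toℕ<n; toℕ-fromℕ<)
open import Data.Product using (Σ; ∃; ∃₂; _×_; _,_)
open import Data.Empty using (⊥-elim)
open import Relation.Binary.PropositionalEquality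
open import Function.Consequences.Propositional
  using (inverseᵇ⇒bijective; strictlyInverseˡ⇒inverseˡ; strictlyInverseʳ⇒inverseʳ)

open ≡-Reasoning

[m%d+n]%d≡[m+n]%d : ∀ m n d .{{_ : NonZero d}} → (m % d + n) % d ≡ (m + n) % d
[m%d+n]%d≡[m+n]%d m n d = begin
  (m % d + n) % d         ≡⟨ %-distribˡ-+ (m % d) n d ⟩
  (m % d % d + n % d) % d ≡⟨ cong (λ r → (r + n % d) % d) (m%n%n≡m%n m d) ⟩
  (m % d + n % d) % d     ≡⟨ %-distribˡ-+ m n d ⟨
  (m + n) % d             ∎

[m+n%d]%d≡[m+n]%d : ∀ m n d .{{_ : NonZero d}} → (m + n % d) % d ≡ (m + n) % d
[m+n%d]%d≡[m+n]%d m n d = begin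
  (m + n % d) % d ≡⟨ cong (_% d) (+-comm m (n % d)) ⟩
  (n % d + m) % d ≡⟨ [m%d+n]%d≡[m+n]%d n m d ⟩
  (n + m) % d     ≡⟨ cong (_% d) (+-comm n m) ⟩
  (m + n) % d     ∎

[m%d*n]%d≡[m*n]%d : ∀ m n d .{{_ : NonZero d}} → (m % d * n) % d ≡ (m * n) % d
[m%d*n]%d≡[m*n]%d m n d = begin
  (m % d * n) % d           ≡⟨ %-distribˡ-* (m % d) n d ⟩
  (m % d % d * (n % d)) % d ≡⟨ cong (λ r → (r * (n % d)) % d) (m%n%n≡m%n m d) ⟩
  (m % d * (n % d)) % d     ≡⟨ %-distribˡ-* m n d ⟨
  (m * n) % d               ∎

[m*n%d]%d≡[m*n]%d : ∀ m n d .{{_ : NonZero d}} → (m * (n % d)) % d ≡ (m * n) % d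
[m*n%d]%d≡[m*n]%d m n d = begin
  (m * (n % d)) % d ≡⟨ cong (_% d) (*-comm m (n % d)) ⟩
  (n % d * m) % d   ≡⟨ [m%d*n]%d≡[m*n]%d n m d ⟩
  (n * m) % d       ≡⟨ cong (_% d) (*-comm n m) ⟩
  (m * n) % d       ∎

coprime⇒invertible : ∀ {m} n .{{_ : NonZero n}} → Coprime m n → ∃ λ i → (i * m) % n ≡ 1 % n
coprime⇒invertible {m} n c with coprime-Bézout c
... | Bézout.+- x y eq = x , (begin
  (x * m) % n     ≡⟨ cong (_% n) eq ⟨
  (1 + y * n) % n ≡⟨ [m+kn]%n≡m%n 1 y n ⟩
  1 % n           ∎)
... | Bézout.-+ x y eq = x * pred n , (begin
  (x * pred n * m) % n                  ≡⟨ [m+kn]%n≡m%n (x * pred n * m) y n ⟨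
  (x * pred n * m + y * n) % n          ≡⟨ cong (λ r → (x * pred n * m + r) % n) eq ⟨
  (x * pred n * m + (1 + x * m)) % n    ≡⟨ cong (_% n) (regroup x (pred n) m) ⟩
  (1 + x * m * suc (pred n)) % n        ≡⟨ cong (λ r → (1 + x * m * r) % n) (suc-pred n) ⟩
  (1 + x * m * n) % n                   ≡⟨ [m+kn]%n≡m%n 1 (x * m) n ⟩
  1 % n                                 ∎)
  where
  regroup : ∀ x p m → x * p * m + (1 + x * m) ≡ 1 + x * m * suc p
  regroup = solve-∀

module _ (n : ℕ) .{{_ : NonZero n}} where

  private
    infixl 6 _+ᶜ_
    infixr 7 _·ᶜ_

    _+ᶜ_ : C n → C n → C n
    _+ᶜ_ = _⊕_ n

    _·ᶜ_ : ℕ → C n → C n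
    _·ᶜ_ = _·_ n

  toℕ-mod : ∀ m → toℕ (m mod n) ≡ m % n
  toℕ-mod m = toℕ-fromℕ< (m%n<n m n)

  toℕ-0C : toℕ (0C n) ≡ 0
  toℕ-0C = trans (toℕ-mod 0) (m<n⇒m%n≡m (>-nonZero⁻¹ n))

  toℕ-⊕ : ∀ x y → toℕ (x +ᶜ y) ≡ (toℕ x + toℕ y) % n
  toℕ-⊕ x y = toℕ-mod (toℕ x + toℕ y)

  toℕ-· : ∀ k x → toℕ (k ·ᶜ x) ≡ (k * toℕ x) % n
  toℕ-· zero    x = toℕ-mod 0
  toℕ-· (suc k) x = begin
    toℕ (x +ᶜ k ·ᶜ x)                ≡⟨ toℕ-⊕ x (k ·ᶜ x) ⟩
    (toℕ x + toℕ (k ·ᶜ x)) % n       ≡⟨ cong (λ r → (toℕ x + r) % n) (toℕ-· k x) ⟩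
    (toℕ x + (k * toℕ x) % n) % n    ≡⟨ [m+n%d]%d≡[m+n]%d (toℕ x) (k * toℕ x) n ⟩
    (toℕ x + k * toℕ x) % n          ∎

  ⊕-assoc : ∀ x y z → (x +ᶜ y) +ᶜ z ≡ x +ᶜ (y +ᶜ z)
  ⊕-assoc x y z = toℕ-injective (begin
    toℕ ((x +ᶜ y) +ᶜ z)                  ≡⟨ toℕ-⊕ (x +ᶜ y) z ⟩
    (toℕ (x +ᶜ y) + toℕ z) % n           ≡⟨ cong (λ r → (r + toℕ z) % n) (toℕ-⊕ x y) ⟩
    ((toℕ x + toℕ y) % n + toℕ z) % n    ≡⟨ [m%d+n]%d≡[m+n]%d (toℕ x + toℕ y) (toℕ z) n ⟩
    (toℕ x + toℕ y + toℕ z) % n          ≡⟨ cong (_% n) (+-assoc (toℕ x) (toℕ y) (toℕ z)) ⟩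
    (toℕ x + (toℕ y + toℕ z)) % n        ≡⟨ [m+n%d]%d≡[m+n]%d (toℕ x) (toℕ y + toℕ z) n ⟨
    (toℕ x + (toℕ y + toℕ z) % n) % n    ≡⟨ cong (λ r → (toℕ x + r) % n) (toℕ-⊕ y z) ⟨
    (toℕ x + toℕ (y +ᶜ z)) % n           ≡⟨ toℕ-⊕ x (y +ᶜ z) ⟨
    toℕ (x +ᶜ (y +ᶜ z))                  ∎)

  ·-cong-% : ∀ {p q} → p % n ≡ q % n → ∀ x → p ·ᶜ x ≡ q ·ᶜ x
  ·-cong-% {p} {q} p≡q x = toℕ-injective (begin
    toℕ (p ·ᶜ x)            ≡⟨ toℕ-· p x ⟩
    (p * toℕ x) % n         ≡⟨ [m%d*n]%d≡[m*n]%d p (toℕ x) n ⟨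
    (p % n * toℕ x) % n     ≡⟨ cong (λ r → (r * toℕ x) % n) p≡q ⟩
    (q % n * toℕ x) % n     ≡⟨ [m%d*n]%d≡[m*n]%d q (toℕ x) n ⟩
    (q * toℕ x) % n         ≡⟨ toℕ-· q x ⟨
    toℕ (q ·ᶜ x)            ∎)

  ·-identityˡ : ∀ x → 1 ·ᶜ x ≡ x
  ·-identityˡ x = toℕ-injective (begin
    toℕ (1 ·ᶜ x)      ≡⟨ toℕ-· 1 x ⟩
    (1 * toℕ x) % n   ≡⟨ cong (_% n) (*-identityˡ (toℕ x)) ⟩
    toℕ x % n         ≡⟨ m<n⇒m%n≡m (toℕ<n x) ⟩
    toℕ x             ∎)

  ·-assoc : ∀ p q x → p ·ᶜ q ·ᶜ x ≡ (p * q) ·ᶜ x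
  ·-assoc p q x = toℕ-injective (begin
    toℕ (p ·ᶜ q ·ᶜ x)           ≡⟨ toℕ-· p (q ·ᶜ x) ⟩
    (p * toℕ (q ·ᶜ x)) % n      ≡⟨ cong (λ r → (p * r) % n) (toℕ-· q x) ⟩
    (p * ((q * toℕ x) % n)) % n ≡⟨ [m*n%d]%d≡[m*n]%d p (q * toℕ x) n ⟩
    (p * (q * toℕ x)) % n       ≡⟨ cong (_% n) (*-assoc p q (toℕ x)) ⟨
    (p * q * toℕ x) % n         ≡⟨ toℕ-· (p * q) x ⟨
    toℕ ((p * q) ·ᶜ x)          ∎)

  ·-swap : ∀ x y → toℕ x ·ᶜ y ≡ toℕ y ·ᶜ x
  ·-swap x y = toℕ-injective (begin
    toℕ (toℕ x ·ᶜ y)     ≡⟨ toℕ-· (toℕ x) y ⟩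
    (toℕ x * toℕ y) % n  ≡⟨ cong (_% n) (*-comm (toℕ x) (toℕ y)) ⟩
    (toℕ y * toℕ x) % n  ≡⟨ toℕ-· (toℕ y) x ⟨
    toℕ (toℕ y ·ᶜ x)     ∎)

  ·-distribˡ-⊕ : ∀ k x y → k ·ᶜ (x +ᶜ y) ≡ k ·ᶜ x +ᶜ k ·ᶜ y
  ·-distribˡ-⊕ k x y = toℕ-injective (begin
    toℕ (k ·ᶜ (x +ᶜ y))                              ≡⟨ toℕ-· k (x +ᶜ y) ⟩
    (k * toℕ (x +ᶜ y)) % n                           ≡⟨ cong (λ r → (k * r) % n) (toℕ-⊕ x y) ⟩
    (k * ((toℕ x + toℕ y) % n)) % n                  ≡⟨ [m*n%d]%d≡[m*n]%d k (toℕ x + toℕ y) n ⟩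
    (k * (toℕ x + toℕ y)) % n                        ≡⟨ cong (_% n) (*-distribˡ-+ k (toℕ x) (toℕ y)) ⟩
    (k * toℕ x + k * toℕ y) % n                      ≡⟨ %-distribˡ-+ (k * toℕ x) (k * toℕ y) n ⟩
    ((k * toℕ x) % n + (k * toℕ y) % n) % n          ≡⟨ cong₂ (λ a b → (a + b) % n) (toℕ-· k x) (toℕ-· k y) ⟨
    (toℕ (k ·ᶜ x) + toℕ (k ·ᶜ y)) % n                ≡⟨ toℕ-⊕ (k ·ᶜ x) (k ·ᶜ y) ⟨
    toℕ (k ·ᶜ x +ᶜ k ·ᶜ y)                           ∎)

  ·-distribʳ-+ : ∀ p q x → (p + q) ·ᶜ x ≡ p ·ᶜ x +ᶜ q ·ᶜ x
  ·-distribʳ-+ p q x = toℕ-injective (begin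
    toℕ ((p + q) ·ᶜ x)                          ≡⟨ toℕ-· (p + q) x ⟩
    ((p + q) * toℕ x) % n                       ≡⟨ cong (_% n) (*-distribʳ-+ (toℕ x) p q) ⟩
    (p * toℕ x + q * toℕ x) % n                 ≡⟨ %-distribˡ-+ (p * toℕ x) (q * toℕ x) n ⟩
    ((p * toℕ x) % n + (q * toℕ x) % n) % n     ≡⟨ cong₂ (λ a b → (a + b) % n) (toℕ-· p x) (toℕ-· q x) ⟨
    (toℕ (p ·ᶜ x) + toℕ (q ·ᶜ x)) % n           ≡⟨ toℕ-⊕ (p ·ᶜ x) (q ·ᶜ x) ⟨
    toℕ (p ·ᶜ x +ᶜ q ·ᶜ x)                      ∎)

  cofactor-annihilates : ∀ s q d r → toℕ s ≡ r * d → n ≡ q * d → q ·ᶜ s ≡ 0C n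
  cofactor-annihilates s q d r s≡r*d n≡q*d = toℕ-injective (begin
    toℕ (q ·ᶜ s)        ≡⟨ toℕ-· q s ⟩
    (q * toℕ s) % n     ≡⟨ cong (λ m → (q * m) % n) s≡r*d ⟩
    (q * (r * d)) % n   ≡⟨ cong (_% n) (x∙yz≈y∙xz q r d) ⟩
    (r * (q * d)) % n   ≡⟨ cong (λ m → (r * m) % n) n≡q*d ⟨
    (r * n) % n         ≡⟨ m*n%n≡0 r n ⟩
    0                   ≡⟨ toℕ-0C ⟨
    toℕ (0C n)          ∎)

  order-n⇒coprime : ∀ s → HasOrder n s n → Coprime (toℕ s) n
  order-n⇒coprime s (_ , _ , minimal) {d} (divides r s≡r*d , divides q n≡q*d) =
    divisor-is-1 d q n≡q*d (cofactor-annihilates s q d r s≡r*d n≡q*d)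
    where
    divisor-is-1 : ∀ d q → n ≡ q * d → q ·ᶜ s ≡ 0C n → d ≡ 1
    divisor-is-1 zero                q         n≡q*0 _    =
      ⊥-elim (<-irrefl (sym (trans n≡q*0 (*-zeroʳ q))) (>-nonZero⁻¹ n))
    divisor-is-1 (suc zero)          _         _     _    = refl
    divisor-is-1 (suc (suc _))       zero      n≡0   _    = ⊥-elim (<-irrefl (sym n≡0) (>-nonZero⁻¹ n))
    divisor-is-1 d@(suc (suc _))     q@(suc _) n≡q*d qs≡0 =
      ⊥-elim (minimal q (s≤s z≤n) (subst (q <_) (sym n≡q*d) (m<m*n q d (s≤s (s≤s z≤n)))) qs≡0)

  ScalingInverses : ℕ → ℕ → Set
  ScalingInverses u v = (∀ x → u ·ᶜ v ·ᶜ x ≡ x) × (∀ x → v ·ᶜ u ·ᶜ x ≡ x)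

  scaling-isAut : ∀ u v → ScalingInverses u v → IsAut n (u ·ᶜ_)
  scaling-isAut u _ (uv , vu) = ·-distribˡ-⊕ u ,
    inverseᵇ⇒bijective (strictlyInverseˡ⇒inverseˡ (u ·ᶜ_) uv , strictlyInverseʳ⇒inverseʳ (u ·ᶜ_) vu)

  inverse-scale : ∀ i (s : C n) → (i * toℕ s) % n ≡ 1 % n → ∀ x → (i * toℕ s) ·ᶜ x ≡ x
  inverse-scale _ s is≡1 x = trans (·-cong-% is≡1 x) (·-identityˡ x)

  scale-onto : ∀ i (s t : C n) → (i * toℕ s) % n ≡ 1 % n → (i * toℕ t) ·ᶜ s ≡ t
  scale-onto i s t is≡1 = begin
    (i * toℕ t) ·ᶜ s   ≡⟨ ·-assoc i (toℕ t) s ⟨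
    i ·ᶜ toℕ t ·ᶜ s    ≡⟨ cong (i ·ᶜ_) (·-swap t s) ⟩
    i ·ᶜ toℕ s ·ᶜ t    ≡⟨ ·-assoc i (toℕ s) t ⟩
    (i * toℕ s) ·ᶜ t   ≡⟨ inverse-scale i s is≡1 t ⟩
    t                  ∎

  scale-onto-cancel : ∀ i j (s t : C n) → (i * toℕ s) % n ≡ 1 % n → (j * toℕ t) % n ≡ 1 % n
                    → ∀ x → (j * toℕ s) ·ᶜ (i * toℕ t) ·ᶜ x ≡ x
  scale-onto-cancel i j s t is≡1 jt≡1 x = begin
    (j * S) ·ᶜ (i * T) ·ᶜ x      ≡⟨ ·-assoc (j * S) (i * T) x ⟩
    (j * S * (i * T)) ·ᶜ x       ≡⟨ cong (_·ᶜ x) (regroup j S i T) ⟩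
    (j * T * (i * S)) ·ᶜ x       ≡⟨ ·-assoc (j * T) (i * S) x ⟨
    (j * T) ·ᶜ (i * S) ·ᶜ x      ≡⟨ cong ((j * T) ·ᶜ_) (inverse-scale i s is≡1 x) ⟩
    (j * T) ·ᶜ x                 ≡⟨ inverse-scale j t jt≡1 x ⟩
    x                            ∎
    where
    S T : ℕ
    S = toℕ s
    T = toℕ t
    regroup : ∀ j S i T → j * S * (i * T) ≡ j * T * (i * S)
    regroup = solve-∀

  scaling-between-units : ∀ s t → HasOrder n s n → HasOrder n t n
                        → ∃₂ λ u v → ScalingInverses u v × u ·ᶜ s ≡ t
  scaling-between-units s t s-order t-order
    with coprime⇒invertible n (order-n⇒coprime s s-order)
       | coprime⇒invertible n (order-n⇒coprime t t-order)
  ... | i , is≡1 | j , jt≡1 =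
    i * toℕ t , j * toℕ s ,
    (scale-onto-cancel j i t s jt≡1 is≡1 , scale-onto-cancel i j s t is≡1 jt≡1) ,
    scale-onto i s t is≡1

  coset-⊕ : ∀ g h a m → (g +ᶜ a ·ᶜ h) +ᶜ m ·ᶜ h ≡ g +ᶜ (a + m) ·ᶜ h
  coset-⊕ g h a m = trans (⊕-assoc g (a ·ᶜ h) (m ·ᶜ h)) (cong (g +ᶜ_) (sym (·-distribʳ-+ a m h)))

  coset-trans : ∀ {g h s y} → Coset n g h s → Coset n s h y → Coset n g h y
  coset-trans {g} {h} (a , refl) (m , refl) = a + m , coset-⊕ g h a m

  coset-recentre : ∀ {g h s y} → Coset n g h s → Coset n g h y → Coset n s h y
  -- a * pred n represents -a modulo n.
  coset-recentre {g} {h} (a , refl) (k , refl) = k + a * pred n , (begin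
    g +ᶜ k ·ᶜ h                            ≡⟨ cong (g +ᶜ_) (·-cong-% wraps-to-k h) ⟨
    g +ᶜ (a + (k + a * pred n)) ·ᶜ h       ≡⟨ coset-⊕ g h a (k + a * pred n) ⟨
    (g +ᶜ a ·ᶜ h) +ᶜ (k + a * pred n) ·ᶜ h ∎)
    where
    regroup : ∀ a k p → a + (k + a * p) ≡ k + a * suc p
    regroup = solve-∀
    wraps-to-k : (a + (k + a * pred n)) % n ≡ k % n
    wraps-to-k = begin
      (a + (k + a * pred n)) % n   ≡⟨ cong (_% n) (regroup a k (pred n)) ⟩
      (k + a * suc (pred n)) % n   ≡⟨ cong (λ m → (k + a * m) % n) (suc-pred n) ⟩
      (k + a * n) % n              ≡⟨ [m+kn]%n≡m%n k a n ⟩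
      k % n                        ∎

  coset-scale : ∀ u {s h y} → Coset n s h y → Coset n (u ·ᶜ s) h (u ·ᶜ y)
  coset-scale u {s} {h} (m , refl) = u * m , (begin
    u ·ᶜ (s +ᶜ m ·ᶜ h)         ≡⟨ ·-distribˡ-⊕ u s (m ·ᶜ h) ⟩
    u ·ᶜ s +ᶜ u ·ᶜ m ·ᶜ h      ≡⟨ cong (u ·ᶜ s +ᶜ_) (·-assoc u m h) ⟩
    u ·ᶜ s +ᶜ (u * m) ·ᶜ h     ∎)

  scaling-preserves-coset : ∀ u {g h s} → Coset n g h s → Coset n g h (u ·ᶜ s)
                          → ∀ y → Coset n g h y → Coset n g h (u ·ᶜ y)
  scaling-preserves-coset u s∈S us∈S y y∈S = coset-trans us∈S (coset-scale u (coset-recentre s∈S y∈S))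

  scaling-stabilises-coset : ∀ u v {g h s} → ScalingInverses u v → Coset n g h s → Coset n g h (u ·ᶜ s)
                           → Stabilises n (u ·ᶜ_) (Coset n g h)
  scaling-stabilises-coset u v {g} {h} {s} (uv , vu) s∈S us∈S =
    scaling-preserves-coset u s∈S us∈S ,
    λ y y∈S → v ·ᶜ y , scaling-preserves-coset v us∈S vus∈S y y∈S , uv y
    where
    vus∈S : Coset n g h (v ·ᶜ u ·ᶜ s)
    vus∈S = subst (Coset n g h) (sym (vu s)) s∈S

lemma2p10 : (n : ℕ) .{{_ : NonZero n}}
    → (N : C n → Set) → IsSubgroup n N → (∀ x → N x → Φ n x)
    → (g h : C n) → N h
    → (∀ y → Coset n g h y → HasOrder n y n)
    → ∀ s t → Coset n g h s → Coset n g h t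
    → Σ (C n → C n) λ σ → IsAut n σ × Stabilises n σ (Coset n g h) × σ s ≡ t
lemma2p10 n _ _ _ g h _ order s t s∈S t∈S =
  let u , v , inverses , us≡t = scaling-between-units n s t (order s s∈S) (order t t∈S)
  in _·_ n u ,
     scaling-isAut n u v inverses ,
     scaling-stabilises-coset n u v inverses s∈S (subst (Coset n g h) (sym us≡t) t∈S) ,
     us≡t
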